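{- Let $a,b,c$ be non-negative integers with $a\le b$ and $c\le b$, and let $x$ be a variable. Then \[ \sum_{l=0}^{b}\binom{l}{c}\binom{x+l}{l-a}=\sum_{s=0}^{c}\binom{x+b+s+1}{b-a}\binom{x+a+s}{s}\binom{x+c}{c-s}(-1)^{c-s}. \]
   Context: For a polynomial (or number) $y$ and an integer $m$, $\binom{y}{m}=y(y-1)\cdots(y-m+1)/m!$ if $m\ge0$ and $\binom{y}{m}=0$ if $m<0$; the identity is an identity of polynomials in $x$. -}

module Defs where

open import Data.Nat using (ℕ; zero; suc)
open import Data.Integer using (ℤ; +_; -[1+_]; _⊖_)
open import Data.Rational using (ℚ; _+_; _*_; _-_; -_; _/_; 0ℚ; 1ℚ)

ℕ→ℚ : ℕ → ℚ
ℕ→ℚ n = (+ n) / 1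

binom : ℚ → ℕ → ℚ
binom y zero = 1ℚ
binom y (suc m) = binom y m * (y - ℕ→ℚ m) * ((+ 1) / suc m)

binomℤ : ℚ → ℤ → ℚ
binomℤ y (+ m) = binom y m
binomℤ y -[1+ m ] = 0ℚ

sgn : ℕ → ℚ
sgn zero = 1ℚ
sgn (suc n) = - sgn n

sumTo : ℕ → (ℕ → ℚ) → ℚ
sumTo zero f = f 0
sumTo (suc n) f = sumTo n f + f (suc n)

{-# OPTIONS --safe #-}
module Submission where

-- Write R(F, m) = Σ_{s≤c} C(F s, m) C(x+a+s, s) C(x+c, c−s) (−1)^(c−s), so that the right-hand
-- side is R(x+b+s+1, b−a).  Trinomial revision turns R(x+n+s, n−a) into C(x+n, n−a) times the
-- alternating convolution Σ_{s≤c} C(x+n+s, s) C(x+c, c−s) (−1)^(c−s), which equals C(n, c): for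
-- n, c > 0 Pascal's rule reduces it to the cases (n−1, c) and (n−1, c−1), and for n = 0 trinomial
-- revision makes it C(x+c, c) times the alternating row sum Σ_j (−1)^j C(c, j), zero for c > 0.
-- So R(x+n+s, n−a) is the n-th summand of the left-hand side.  Pascal's rule, valid for every
-- integer lower index, gives R(x+n+s+1, n−a) = R(x+n+s, n−a) + R(x+(n−1)+s+1, (n−1)−a), and
-- R(F, m) = 0 for m < 0, so both sides satisfy the same recursion in b.

open import Defs
open import Data.Nat using (ℕ; zero; suc; _≤_; _<_; _∸_; s≤s; z≤n)
import Data.Nat as ℕ
import Data.Nat.Properties as ℕ
open import Data.Integer using (ℤ; +_; -[1+_]; _⊖_) renaming (suc to sucℤ)
import Data.Integer as ℤ
import Data.Integer.Properties as ℤ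
import Data.Integer.Tactic.RingSolver as ℤ-Solver
open import Data.Rational using (ℚ; _+_; _*_; _-_; -_; _/_; 0ℚ; 1ℚ; toℚᵘ)
open import Data.Rational.Properties
  using (_≟_; +-*-commutativeRing; toℚᵘ-injective; toℚᵘ-fromℚᵘ; toℚᵘ-homo-+; toℚᵘ-homo-*;
         +-comm; +-assoc; +-identityʳ; *-identityʳ; *-comm; *-assoc; *-zeroˡ; *-zeroʳ; *-distribˡ-+)
open import Data.Rational.Unnormalised using (mkℚᵘ; *≡*)
  renaming (_+_ to _+ᵘ_; _*_ to _*ᵘ_; _≃_ to _≃ᵘ_)
import Data.Rational.Unnormalised.Properties as ℚᵘ
open import Data.Sum using (inj₁; inj₂)
open import Level using (0ℓ)
open import Relation.Nullary.Decidable using (yes; no; dec⇒maybe)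
open import Relation.Binary.PropositionalEquality
  using (_≡_; refl; sym; trans; cong; cong₂; module ≡-Reasoning)
open import Tactic.RingSolver using (solve-∀)
open import Tactic.RingSolver.Core.AlmostCommutativeRing using (AlmostCommutativeRing; fromCommutativeRing)
open ≡-Reasoning

ℚ-ring : AlmostCommutativeRing 0ℓ 0ℓ
ℚ-ring = fromCommutativeRing +-*-commutativeRing (λ q → dec⇒maybe (0ℚ ≟ q))

toℚᵘ-ℕ→ℚ : ∀ n → toℚᵘ (ℕ→ℚ n) ≃ᵘ mkℚᵘ (+ n) 0
toℚᵘ-ℕ→ℚ n = toℚᵘ-fromℚᵘ (mkℚᵘ (+ n) 0)

ℕ→ℚ-+ : ∀ m n → ℕ→ℚ (m ℕ.+ n) ≡ ℕ→ℚ m + ℕ→ℚ n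
ℕ→ℚ-+ m n = toℚᵘ-injective (beginᵘ
  toℚᵘ (ℕ→ℚ (m ℕ.+ n))
    ≈⟨ toℚᵘ-ℕ→ℚ (m ℕ.+ n) ⟩
  mkℚᵘ (+ (m ℕ.+ n)) 0
    ≈⟨ *≡* (trans (cong (ℤ._* (+ 1 ℤ.* + 1)) (ℤ.pos-+ m n)) (integer-identity (+ m) (+ n))) ⟩
  mkℚᵘ (+ m) 0 +ᵘ mkℚᵘ (+ n) 0
    ≈⟨ ℚᵘ.+-cong (toℚᵘ-ℕ→ℚ m) (toℚᵘ-ℕ→ℚ n) ⟨
  toℚᵘ (ℕ→ℚ m) +ᵘ toℚᵘ (ℕ→ℚ n)
    ≈⟨ toℚᵘ-homo-+ (ℕ→ℚ m) (ℕ→ℚ n) ⟨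
  toℚᵘ (ℕ→ℚ m + ℕ→ℚ n)
    ∎ᵘ)
  where
  open ℚᵘ.≃-Reasoning using (step-≈-⟩; step-≈-⟨) renaming (begin_ to beginᵘ_; _∎ to _∎ᵘ)
  integer-identity : ∀ (i j : ℤ) →
    (i ℤ.+ j) ℤ.* (+ 1 ℤ.* + 1) ≡ (i ℤ.* + 1 ℤ.+ j ℤ.* + 1) ℤ.* + 1
  integer-identity = ℤ-Solver.solve-∀

ℕ→ℚ-suc : ∀ n → ℕ→ℚ (suc n) ≡ ℕ→ℚ n + 1ℚ
ℕ→ℚ-suc n = trans (ℕ→ℚ-+ 1 n) (+-comm 1ℚ (ℕ→ℚ n))

1/suc-inverse : ∀ m → ((+ 1) / suc m) * ℕ→ℚ (suc m) ≡ 1ℚ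
1/suc-inverse m = toℚᵘ-injective (beginᵘ
  toℚᵘ ((+ 1) / suc m * ℕ→ℚ (suc m))
    ≈⟨ toℚᵘ-homo-* ((+ 1) / suc m) (ℕ→ℚ (suc m)) ⟩
  toℚᵘ ((+ 1) / suc m) *ᵘ toℚᵘ (ℕ→ℚ (suc m))
    ≈⟨ ℚᵘ.*-cong (toℚᵘ-fromℚᵘ (mkℚᵘ (+ 1) m)) (toℚᵘ-ℕ→ℚ (suc m)) ⟩
  mkℚᵘ (+ 1) m *ᵘ mkℚᵘ (+ suc m) 0
    ≈⟨ *≡* (integer-identity (+ suc m)) ⟩
  toℚᵘ 1ℚ
    ∎ᵘ)
  where
  open ℚᵘ.≃-Reasoning using (step-≈-⟩) renaming (begin_ to beginᵘ_; _∎ to _∎ᵘ)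
  integer-identity : ∀ (i : ℤ) → (+ 1 ℤ.* i) ℤ.* + 1 ≡ + 1 ℤ.* (i ℤ.* + 1)
  integer-identity = ℤ-Solver.solve-∀

sumTo-cong : ∀ n {f g : ℕ → ℚ} → (∀ i → i ≤ n → f i ≡ g i) → sumTo n f ≡ sumTo n g
sumTo-cong zero    f≗g = f≗g 0 z≤n
sumTo-cong (suc n) f≗g =
  cong₂ _+_ (sumTo-cong n (λ i i≤n → f≗g i (ℕ.m≤n⇒m≤1+n i≤n))) (f≗g (suc n) ℕ.≤-refl)

sumTo-0 : ∀ n → sumTo n (λ _ → 0ℚ) ≡ 0ℚ
sumTo-0 zero    = refl
sumTo-0 (suc n) = cong (_+ 0ℚ) (sumTo-0 n)

sumTo-+ : ∀ n f g → sumTo n (λ i → f i + g i) ≡ sumTo n f + sumTo n g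
sumTo-+ zero    f g = refl
sumTo-+ (suc n) f g = trans (cong (_+ (f (suc n) + g (suc n))) (sumTo-+ n f g))
                            (interchange (sumTo n f) (sumTo n g) (f (suc n)) (g (suc n)))
  where
  interchange : ∀ p q r s → (p + q) + (r + s) ≡ (p + r) + (q + s)
  interchange = solve-∀ ℚ-ring

sumTo-*ˡ : ∀ n k f → sumTo n (λ i → k * f i) ≡ k * sumTo n f
sumTo-*ˡ zero    k f = refl
sumTo-*ˡ (suc n) k f = trans (cong (_+ k * f (suc n)) (sumTo-*ˡ n k f))
                             (sym (*-distribˡ-+ k (sumTo n f) (f (suc n))))

sumTo-suc-head : ∀ n f → sumTo (suc n) f ≡ f 0 + sumTo n (λ i → f (suc i))
sumTo-suc-head zero    f = refl
sumTo-suc-head (suc n) f = trans (cong (_+ f (suc (suc n))) (sumTo-suc-head n f))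
                                 (+-assoc (f 0) (sumTo n (λ i → f (suc i))) (f (suc (suc n))))

sumTo-reverse : ∀ n f → sumTo n f ≡ sumTo n (λ i → f (n ∸ i))
sumTo-reverse zero    f = refl
sumTo-reverse (suc n) f = begin
  sumTo (suc n) f
    ≡⟨ sumTo-suc-head n f ⟩
  f 0 + sumTo n (λ i → f (suc i))
    ≡⟨ cong (_+_ (f 0)) (sumTo-reverse n (λ i → f (suc i))) ⟩
  f 0 + sumTo n (λ i → f (suc (n ∸ i)))
    ≡⟨ cong (_+_ (f 0)) (sumTo-cong n (λ i i≤n → cong f (sym (ℕ.+-∸-assoc 1 i≤n)))) ⟩
  f 0 + sumTo n (λ i → f (suc n ∸ i))
    ≡⟨ +-comm (f 0) _ ⟩
  sumTo n (λ i → f (suc n ∸ i)) + f 0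
    ≡⟨ cong (λ i → sumTo n (λ j → f (suc n ∸ j)) + f i) (sym (ℕ.n∸n≡0 n)) ⟩
  sumTo (suc n) (λ i → f (suc n ∸ i))
    ∎

1/suc-recurrence : ∀ k → ((+ 1) / suc k) * ((+ 1) / suc (suc k)) + (+ 1) / suc (suc k) ≡ (+ 1) / suc k
1/suc-recurrence k = begin
  j * i + i                          ≡⟨ insert-one j i ⟩
  j * i + i * 1ℚ                     ≡⟨ cong (λ t → j * i + i * t) (sym (1/suc-inverse k)) ⟩
  j * i + i * (j * ℕ→ℚ (suc k))      ≡⟨ factor j i (ℕ→ℚ (suc k)) ⟩
  j * (i * (ℕ→ℚ (suc k) + 1ℚ))       ≡⟨ cong (λ t → j * (i * t)) (sym (ℕ→ℚ-suc (suc k))) ⟩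
  j * (i * ℕ→ℚ (suc (suc k)))        ≡⟨ cong (_*_ j) (1/suc-inverse (suc k)) ⟩
  j * 1ℚ                             ≡⟨ *-identityʳ j ⟩
  j                                  ∎
  where
  j = (+ 1) / suc k
  i = (+ 1) / suc (suc k)
  insert-one : ∀ j i → j * i + i ≡ j * i + i * 1ℚ
  insert-one = solve-∀ ℚ-ring
  factor : ∀ j i n → j * i + i * (j * n) ≡ j * (i * (n + 1ℚ))
  factor = solve-∀ ℚ-ring

binom-pascal : ∀ m y → binom (y + 1ℚ) (suc m) ≡ binom y (suc m) + binom y m
binom-pascal zero    y = first-row y
  where
  first-row : ∀ y → 1ℚ * ((y + 1ℚ) - 0ℚ) * 1ℚ ≡ 1ℚ * (y - 0ℚ) * 1ℚ + 1ℚ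
  first-row = solve-∀ ℚ-ring
binom-pascal (suc k) y = begin
  binom (y + 1ℚ) (suc k) * ((y + 1ℚ) - ℕ→ℚ (suc k)) * i
    ≡⟨ cong₂ (λ b t → b * ((y + 1ℚ) - t) * i) (binom-pascal k y) (ℕ→ℚ-suc k) ⟩
  (c * (y - n) * j + c) * ((y + 1ℚ) - (n + 1ℚ)) * i
    ≡⟨ expand c y n i j ⟩
  c * (y - n) * ((y - n) - 1ℚ) * j * i + c * (y - n) * (j * i + i)
    ≡⟨ cong (λ t → c * (y - n) * ((y - n) - 1ℚ) * j * i + c * (y - n) * t) (1/suc-recurrence k) ⟩
  c * (y - n) * ((y - n) - 1ℚ) * j * i + c * (y - n) * j
    ≡⟨ regroup c y n i j ⟩
  c * (y - n) * j * (y - (n + 1ℚ)) * i + c * (y - n) * j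
    ≡⟨ cong (λ t → c * (y - n) * j * (y - t) * i + c * (y - n) * j) (sym (ℕ→ℚ-suc k)) ⟩
  binom y (suc (suc k)) + binom y (suc k)
    ∎
  where
  c = binom y k
  n = ℕ→ℚ k
  j = (+ 1) / suc k
  i = (+ 1) / suc (suc k)
  expand : ∀ c y n i j → (c * (y - n) * j + c) * ((y + 1ℚ) - (n + 1ℚ)) * i
                         ≡ c * (y - n) * ((y - n) - 1ℚ) * j * i + c * (y - n) * (j * i + i)
  expand = solve-∀ ℚ-ring
  regroup : ∀ c y n i j → c * (y - n) * ((y - n) - 1ℚ) * j * i + c * (y - n) * j
                          ≡ c * (y - n) * j * (y - (n + 1ℚ)) * i + c * (y - n) * j
  regroup = solve-∀ ℚ-ring

binom-absorption : ∀ m z → binom z m * (z - ℕ→ℚ m) ≡ z * binom (z - 1ℚ) m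
binom-absorption zero    z = base z
  where
  base : ∀ z → 1ℚ * (z - 0ℚ) ≡ z * 1ℚ
  base = solve-∀ ℚ-ring
binom-absorption (suc k) z = begin
  binom z k * (z - ℕ→ℚ k) * j * (z - ℕ→ℚ (suc k))
    ≡⟨ cong₂ (λ b t → b * j * (z - t)) (binom-absorption k z) (ℕ→ℚ-suc k) ⟩
  z * binom (z - 1ℚ) k * j * (z - (ℕ→ℚ k + 1ℚ))
    ≡⟨ regroup z (binom (z - 1ℚ) k) (ℕ→ℚ k) j ⟩
  z * (binom (z - 1ℚ) k * ((z - 1ℚ) - ℕ→ℚ k) * j)
    ∎
  where
  j = (+ 1) / suc k
  regroup : ∀ z b n j → z * b * j * (z - (n + 1ℚ)) ≡ z * (b * ((z - 1ℚ) - n) * j)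
  regroup = solve-∀ ℚ-ring

ℕ→ℚ-suc-∸-1 : ∀ n → ℕ→ℚ (suc n) - 1ℚ ≡ ℕ→ℚ n
ℕ→ℚ-suc-∸-1 n = trans (cong (_- 1ℚ) (ℕ→ℚ-suc n)) (cancel (ℕ→ℚ n))
  where
  cancel : ∀ p → (p + 1ℚ) - 1ℚ ≡ p
  cancel = solve-∀ ℚ-ring

binom-ℕ-diagonal : ∀ n → binom (ℕ→ℚ n) n ≡ 1ℚ
binom-ℕ-diagonal zero    = refl
binom-ℕ-diagonal (suc n) = begin
  binom N n * (N - ℕ→ℚ n) * j      ≡⟨ cong (_* j) (binom-absorption n N) ⟩
  N * binom (N - 1ℚ) n * j         ≡⟨ cong (λ t → N * binom t n * j) (ℕ→ℚ-suc-∸-1 n) ⟩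
  N * binom (ℕ→ℚ n) n * j          ≡⟨ cong (λ t → N * t * j) (binom-ℕ-diagonal n) ⟩
  N * 1ℚ * j                       ≡⟨ swap N j ⟩
  j * N                            ≡⟨ 1/suc-inverse n ⟩
  1ℚ                               ∎
  where
  N = ℕ→ℚ (suc n)
  j = (+ 1) / suc n
  swap : ∀ p q → p * 1ℚ * q ≡ q * p
  swap = solve-∀ ℚ-ring

binom-ℕ-above : ∀ {n m} → n < m → binom (ℕ→ℚ n) m ≡ 0ℚ
binom-ℕ-above {n} {suc m} (s≤s n≤m) with ℕ.m≤n⇒m<n∨m≡n n≤m
... | inj₁ n<m  = trans (cong (λ b → b * (ℕ→ℚ n - ℕ→ℚ m) * ((+ 1) / suc m)) (binom-ℕ-above n<m))
                        (vanish (ℕ→ℚ n - ℕ→ℚ m) ((+ 1) / suc m))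
  where
  vanish : ∀ p q → 0ℚ * p * q ≡ 0ℚ
  vanish = solve-∀ ℚ-ring
... | inj₂ refl = vanish (binom (ℕ→ℚ n) n) (ℕ→ℚ n) ((+ 1) / suc n)
  where
  vanish : ∀ b n j → b * (n - n) * j ≡ 0ℚ
  vanish = solve-∀ ℚ-ring

binom-*-binom-comm : ∀ k m y → binom y m * binom (y - ℕ→ℚ m) k ≡ binom y k * binom (y - ℕ→ℚ k) m
binom-*-binom-comm zero    m y =
  trans (*-comm (binom y m) 1ℚ) (cong (λ t → 1ℚ * binom t m) (sym (minus-zero y)))
  where
  minus-zero : ∀ y → y - 0ℚ ≡ y
  minus-zero = solve-∀ ℚ-ring
binom-*-binom-comm (suc k) m y = begin
  binom y m * (binom (y - M) k * ((y - M) - K) * j)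
    ≡⟨ regroup₁ (binom y m) (binom (y - M) k) y M K j ⟩
  binom y m * binom (y - M) k * ((y - K) - M) * j
    ≡⟨ cong (λ t → t * ((y - K) - M) * j) (binom-*-binom-comm k m y) ⟩
  binom y k * binom (y - K) m * ((y - K) - M) * j
    ≡⟨ regroup₂ (binom y k) (binom (y - K) m) ((y - K) - M) j ⟩
  binom y k * (binom (y - K) m * ((y - K) - M)) * j
    ≡⟨ cong (λ t → binom y k * t * j) (binom-absorption m (y - K)) ⟩
  binom y k * ((y - K) * binom ((y - K) - 1ℚ) m) * j
    ≡⟨ regroup₃ (binom y k) (y - K) (binom ((y - K) - 1ℚ) m) j ⟩
  binom y k * (y - K) * j * binom ((y - K) - 1ℚ) m
    ≡⟨ cong (λ t → binom y k * (y - K) * j * binom t m) (minus-suc y k) ⟩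
  binom y k * (y - K) * j * binom (y - ℕ→ℚ (suc k)) m
    ∎
  where
  M = ℕ→ℚ m
  K = ℕ→ℚ k
  j = (+ 1) / suc k
  regroup₁ : ∀ a b y m n j → a * (b * ((y - m) - n) * j) ≡ a * b * ((y - n) - m) * j
  regroup₁ = solve-∀ ℚ-ring
  regroup₂ : ∀ a b d j → a * b * d * j ≡ a * (b * d) * j
  regroup₂ = solve-∀ ℚ-ring
  regroup₃ : ∀ a w e j → a * (w * e) * j ≡ a * w * j * e
  regroup₃ = solve-∀ ℚ-ring
  minus-suc : ∀ y k → (y - ℕ→ℚ k) - 1ℚ ≡ y - ℕ→ℚ (suc k)
  minus-suc y k = trans (sub-sub y (ℕ→ℚ k)) (cong (_-_ y) (sym (ℕ→ℚ-suc k)))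
    where
    sub-sub : ∀ y n → (y - n) - 1ℚ ≡ y - (n + 1ℚ)
    sub-sub = solve-∀ ℚ-ring

binom-ℕ-upper-step : ∀ k m →
  binom (ℕ→ℚ (k ℕ.+ m)) m * ((+ 1) / suc k) ≡ ((+ 1) / suc (k ℕ.+ m)) * binom (ℕ→ℚ (suc (k ℕ.+ m))) m
binom-ℕ-upper-step k m = begin
  binom (ℕ→ℚ K) m * j
    ≡⟨ insert-one (binom (ℕ→ℚ K) m) j ⟩
  1ℚ * binom (ℕ→ℚ K) m * j
    ≡⟨ cong (λ t → t * binom (ℕ→ℚ K) m * j) (sym (1/suc-inverse K)) ⟩
  i * Z * binom (ℕ→ℚ K) m * j
    ≡⟨ regroup₁ i Z (binom (ℕ→ℚ K) m) j ⟩
  i * (Z * binom (ℕ→ℚ K) m) * j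
    ≡⟨ cong (λ t → i * t * j) (sym absorbed) ⟩
  i * (binom Z m * ℕ→ℚ (suc k)) * j
    ≡⟨ regroup₂ i (binom Z m) (ℕ→ℚ (suc k)) j ⟩
  i * binom Z m * (j * ℕ→ℚ (suc k))
    ≡⟨ cong (_*_ (i * binom Z m)) (1/suc-inverse k) ⟩
  i * binom Z m * 1ℚ
    ≡⟨ *-identityʳ (i * binom Z m) ⟩
  i * binom Z m
    ∎
  where
  K = k ℕ.+ m
  Z = ℕ→ℚ (suc K)
  j = (+ 1) / suc k
  i = (+ 1) / suc K
  add-sub : ∀ p q → (p + q) - q ≡ p
  add-sub = solve-∀ ℚ-ring
  insert-one : ∀ b j → b * j ≡ 1ℚ * b * j
  insert-one = solve-∀ ℚ-ring
  regroup₁ : ∀ i z b j → i * z * b * j ≡ i * (z * b) * j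
  regroup₁ = solve-∀ ℚ-ring
  regroup₂ : ∀ i p w j → i * (p * w) * j ≡ i * p * (j * w)
  regroup₂ = solve-∀ ℚ-ring
  Z-m : Z - ℕ→ℚ m ≡ ℕ→ℚ (suc k)
  Z-m = trans (cong (_- ℕ→ℚ m) (ℕ→ℚ-+ (suc k) m)) (add-sub (ℕ→ℚ (suc k)) (ℕ→ℚ m))
  absorbed : binom Z m * ℕ→ℚ (suc k) ≡ Z * binom (ℕ→ℚ K) m
  absorbed = begin
    binom Z m * ℕ→ℚ (suc k)     ≡⟨ cong (_*_ (binom Z m)) (sym Z-m) ⟩
    binom Z m * (Z - ℕ→ℚ m)     ≡⟨ binom-absorption m Z ⟩
    Z * binom (Z - 1ℚ) m         ≡⟨ cong (λ t → Z * binom t m) (ℕ→ℚ-suc-∸-1 K) ⟩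
    Z * binom (ℕ→ℚ K) m          ∎

binom-trinomial-revision : ∀ k m y →
  binom y m * binom (y - ℕ→ℚ m) k ≡ binom y (k ℕ.+ m) * binom (ℕ→ℚ (k ℕ.+ m)) m
binom-trinomial-revision zero    m y = cong (_*_ (binom y m)) (sym (binom-ℕ-diagonal m))
binom-trinomial-revision (suc k) m y = begin
  binom y m * (binom (y - M) k * ((y - M) - ℕ→ℚ k) * j)
    ≡⟨ regroup₁ (binom y m) (binom (y - M) k) ((y - M) - ℕ→ℚ k) j ⟩
  binom y m * binom (y - M) k * ((y - M) - ℕ→ℚ k) * j
    ≡⟨ cong₂ (λ b t → b * t * j) (binom-trinomial-revision k m y) y-M-k ⟩
  binom y K * binom (ℕ→ℚ K) m * (y - ℕ→ℚ K) * j
    ≡⟨ regroup₂ (binom y K) (binom (ℕ→ℚ K) m) (y - ℕ→ℚ K) j ⟩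
  binom y K * (y - ℕ→ℚ K) * (binom (ℕ→ℚ K) m * j)
    ≡⟨ cong (λ t → binom y K * (y - ℕ→ℚ K) * t) (binom-ℕ-upper-step k m) ⟩
  binom y K * (y - ℕ→ℚ K) * (i * binom (ℕ→ℚ (suc K)) m)
    ≡⟨ regroup₃ (binom y K) (y - ℕ→ℚ K) i (binom (ℕ→ℚ (suc K)) m) ⟩
  binom y K * (y - ℕ→ℚ K) * i * binom (ℕ→ℚ (suc K)) m
    ∎
  where
  K = k ℕ.+ m
  M = ℕ→ℚ m
  j = (+ 1) / suc k
  i = (+ 1) / suc K
  sub-sub : ∀ y p q → (y - q) - p ≡ y - (p + q)
  sub-sub = solve-∀ ℚ-ring
  regroup₁ : ∀ a b d j → a * (b * d * j) ≡ a * b * d * j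
  regroup₁ = solve-∀ ℚ-ring
  regroup₂ : ∀ a b d j → a * b * d * j ≡ a * d * (b * j)
  regroup₂ = solve-∀ ℚ-ring
  regroup₃ : ∀ a d i p → a * d * (i * p) ≡ a * d * i * p
  regroup₃ = solve-∀ ℚ-ring
  y-M-k : (y - M) - ℕ→ℚ k ≡ y - ℕ→ℚ K
  y-M-k = trans (sub-sub y (ℕ→ℚ k) M) (cong (_-_ y) (sym (ℕ→ℚ-+ k m)))

binom-alternating-partial-sum : ∀ y k → sumTo k (λ j → binom y j * sgn j) ≡ binom (y - 1ℚ) k * sgn k
binom-alternating-partial-sum y zero    = refl
binom-alternating-partial-sum y (suc k) = begin
  sumTo k (λ j → binom y j * sgn j) + binom y (suc k) * - sgn k
    ≡⟨ cong₂ (λ p b → p + b * - sgn k) (binom-alternating-partial-sum y k) y-pascal ⟩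
  binom (y - 1ℚ) k * sgn k + (binom (y - 1ℚ) (suc k) + binom (y - 1ℚ) k) * - sgn k
    ≡⟨ cancel (binom (y - 1ℚ) k) (binom (y - 1ℚ) (suc k)) (sgn k) ⟩
  binom (y - 1ℚ) (suc k) * - sgn k
    ∎
  where
  sub-add : ∀ y → (y - 1ℚ) + 1ℚ ≡ y
  sub-add = solve-∀ ℚ-ring
  cancel : ∀ a b s → a * s + (b + a) * - s ≡ b * - s
  cancel = solve-∀ ℚ-ring
  y-pascal : binom y (suc k) ≡ binom (y - 1ℚ) (suc k) + binom (y - 1ℚ) k
  y-pascal = trans (cong (λ t → binom t (suc k)) (sym (sub-add y))) (binom-pascal k (y - 1ℚ))

binom-ℕ-alternating-row-sum : ∀ n → sumTo (suc n) (λ j → binom (ℕ→ℚ (suc n)) j * sgn j) ≡ 0ℚ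
binom-ℕ-alternating-row-sum n = begin
  sumTo (suc n) (λ j → binom (ℕ→ℚ (suc n)) j * sgn j)
    ≡⟨ binom-alternating-partial-sum (ℕ→ℚ (suc n)) (suc n) ⟩
  binom (ℕ→ℚ (suc n) - 1ℚ) (suc n) * sgn (suc n)
    ≡⟨ cong (λ t → binom t (suc n) * sgn (suc n)) (ℕ→ℚ-suc-∸-1 n) ⟩
  binom (ℕ→ℚ n) (suc n) * sgn (suc n)
    ≡⟨ cong (_* sgn (suc n)) (binom-ℕ-above {n} ℕ.≤-refl) ⟩
  0ℚ * sgn (suc n)
    ≡⟨ *-zeroˡ (sgn (suc n)) ⟩
  0ℚ
    ∎

sum-binom-*-binom-alternating : ∀ x c →
  sumTo c (λ s → binom (x + ℕ→ℚ s) s * binom (x + ℕ→ℚ c) (c ∸ s) * sgn (c ∸ s))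
    ≡ binom (x + ℕ→ℚ c) c * sumTo c (λ j → binom (ℕ→ℚ c) j * sgn j)
sum-binom-*-binom-alternating x c = begin
  sumTo c g
    ≡⟨ sumTo-reverse c g ⟩
  sumTo c (λ j → g (c ∸ j))
    ≡⟨ sumTo-cong c reversed-term ⟩
  sumTo c (λ j → binom y c * (binom (ℕ→ℚ c) j * sgn j))
    ≡⟨ sumTo-*ˡ c (binom y c) (λ j → binom (ℕ→ℚ c) j * sgn j) ⟩
  binom y c * sumTo c (λ j → binom (ℕ→ℚ c) j * sgn j)
    ∎
  where
  y = x + ℕ→ℚ c
  g : ℕ → ℚ
  g s = binom (x + ℕ→ℚ s) s * binom y (c ∸ s) * sgn (c ∸ s)
  add-sub : ∀ x p q → (x + (p + q)) - q ≡ x + p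
  add-sub = solve-∀ ℚ-ring
  reversed-term : ∀ j → j ≤ c → g (c ∸ j) ≡ binom y c * (binom (ℕ→ℚ c) j * sgn j)
  reversed-term j j≤c = begin
    binom (x + ℕ→ℚ k) k * binom y (c ∸ k) * sgn (c ∸ k)
      ≡⟨ cong (λ i → binom (x + ℕ→ℚ k) k * binom y i * sgn i) (ℕ.m∸[m∸n]≡n j≤c) ⟩
    binom (x + ℕ→ℚ k) k * binom y j * sgn j
      ≡⟨ cong (λ t → binom t k * binom y j * sgn j) x+k≡y-j ⟩
    binom (y - ℕ→ℚ j) k * binom y j * sgn j
      ≡⟨ cong (_* sgn j) (*-comm (binom (y - ℕ→ℚ j) k) (binom y j)) ⟩
    binom y j * binom (y - ℕ→ℚ j) k * sgn j
      ≡⟨ cong (_* sgn j) (binom-trinomial-revision k j y) ⟩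
    binom y (k ℕ.+ j) * binom (ℕ→ℚ (k ℕ.+ j)) j * sgn j
      ≡⟨ cong (λ i → binom y i * binom (ℕ→ℚ i) j * sgn j) k+j≡c ⟩
    binom y c * binom (ℕ→ℚ c) j * sgn j
      ≡⟨ *-assoc (binom y c) (binom (ℕ→ℚ c) j) (sgn j) ⟩
    binom y c * (binom (ℕ→ℚ c) j * sgn j)
      ∎
    where
    k = c ∸ j
    k+j≡c : k ℕ.+ j ≡ c
    k+j≡c = ℕ.m∸n+n≡m j≤c
    x+k≡y-j : x + ℕ→ℚ k ≡ y - ℕ→ℚ j
    x+k≡y-j = sym (begin
      (x + ℕ→ℚ c) - ℕ→ℚ j
        ≡⟨ cong (λ i → (x + ℕ→ℚ i) - ℕ→ℚ j) (sym k+j≡c) ⟩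
      (x + ℕ→ℚ (k ℕ.+ j)) - ℕ→ℚ j
        ≡⟨ cong (λ t → (x + t) - ℕ→ℚ j) (ℕ→ℚ-+ k j) ⟩
      (x + (ℕ→ℚ k + ℕ→ℚ j)) - ℕ→ℚ j
        ≡⟨ add-sub x (ℕ→ℚ k) (ℕ→ℚ j) ⟩
      x + ℕ→ℚ k
        ∎)

convolution-term : ℚ → ℕ → ℕ → ℕ → ℚ
convolution-term x b c s =
  binom (x + ℕ→ℚ b + ℕ→ℚ s) s * binom (x + ℕ→ℚ c) (c ∸ s) * sgn (c ∸ s)

convolution-term-pascal : ∀ x b c t →
  convolution-term x (suc b) (suc c) (suc t)
    ≡ convolution-term x b (suc c) (suc t) + convolution-term (x + 1ℚ) b c t
convolution-term-pascal x b c t = begin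
  binom (x + ℕ→ℚ (suc b) + ℕ→ℚ (suc t)) (suc t) * d * s
    ≡⟨ cong (λ u → binom (x + u + ℕ→ℚ (suc t)) (suc t) * d * s) (ℕ→ℚ-suc b) ⟩
  binom (x + (ℕ→ℚ b + 1ℚ) + ℕ→ℚ (suc t)) (suc t) * d * s
    ≡⟨ cong (λ u → binom u (suc t) * d * s) (shift₁ x (ℕ→ℚ b) (ℕ→ℚ (suc t))) ⟩
  binom (Y + 1ℚ) (suc t) * d * s
    ≡⟨ cong (λ u → u * d * s) (binom-pascal t Y) ⟩
  (binom Y (suc t) + binom Y t) * d * s
    ≡⟨ distrib (binom Y (suc t)) (binom Y t) d s ⟩
  binom Y (suc t) * d * s + binom Y t * d * s
    ≡⟨ cong₂ (λ u v → binom Y (suc t) * d * s + binom u t * binom v (c ∸ t) * s) Y≡ x+suc-c≡ ⟩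
  convolution-term x b (suc c) (suc t) + convolution-term (x + 1ℚ) b c t
    ∎
  where
  Y = x + ℕ→ℚ b + ℕ→ℚ (suc t)
  d = binom (x + ℕ→ℚ (suc c)) (c ∸ t)
  s = sgn (c ∸ t)
  shift₁ : ∀ x p q → x + (p + 1ℚ) + q ≡ x + p + q + 1ℚ
  shift₁ = solve-∀ ℚ-ring
  shift₂ : ∀ x p q → x + p + (q + 1ℚ) ≡ x + 1ℚ + p + q
  shift₂ = solve-∀ ℚ-ring
  shift₃ : ∀ x p → x + (p + 1ℚ) ≡ x + 1ℚ + p
  shift₃ = solve-∀ ℚ-ring
  distrib : ∀ p q d s → (p + q) * d * s ≡ p * d * s + q * d * s
  distrib = solve-∀ ℚ-ring
  Y≡ : Y ≡ x + 1ℚ + ℕ→ℚ b + ℕ→ℚ t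
  Y≡ = trans (cong (λ u → x + ℕ→ℚ b + u) (ℕ→ℚ-suc t)) (shift₂ x (ℕ→ℚ b) (ℕ→ℚ t))
  x+suc-c≡ : x + ℕ→ℚ (suc c) ≡ x + 1ℚ + ℕ→ℚ c
  x+suc-c≡ = trans (cong (_+_ x) (ℕ→ℚ-suc c)) (shift₃ x (ℕ→ℚ c))

sum-convolution-term : ∀ b c x → sumTo c (convolution-term x b c) ≡ binom (ℕ→ℚ b) c
sum-convolution-term b       zero    x = refl
sum-convolution-term zero    (suc c) x = begin
  sumTo (suc c) (convolution-term x 0 (suc c))
    ≡⟨ sumTo-cong (suc c) (λ s _ → cong (λ t → binom t s * binom y (suc c ∸ s) * sgn (suc c ∸ s))
                                        (plus-zero x (ℕ→ℚ s))) ⟩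
  sumTo (suc c) (λ s → binom (x + ℕ→ℚ s) s * binom y (suc c ∸ s) * sgn (suc c ∸ s))
    ≡⟨ sum-binom-*-binom-alternating x (suc c) ⟩
  binom y (suc c) * sumTo (suc c) (λ j → binom (ℕ→ℚ (suc c)) j * sgn j)
    ≡⟨ cong (_*_ (binom y (suc c))) (binom-ℕ-alternating-row-sum c) ⟩
  binom y (suc c) * 0ℚ
    ≡⟨ *-zeroʳ (binom y (suc c)) ⟩
  0ℚ
    ≡⟨ binom-ℕ-above {0} {suc c} (s≤s z≤n) ⟨
  binom (ℕ→ℚ 0) (suc c)
    ∎
  where
  y = x + ℕ→ℚ (suc c)
  plus-zero : ∀ x p → x + 0ℚ + p ≡ x + p
  plus-zero = solve-∀ ℚ-ring
sum-convolution-term (suc b) (suc c) x = begin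
  sumTo (suc c) f
    ≡⟨ sumTo-suc-head c f ⟩
  f 0 + sumTo c (λ t → f (suc t))
    ≡⟨ cong (_+_ (f 0)) (sumTo-cong c (λ t _ → convolution-term-pascal x b c t)) ⟩
  f 0 + sumTo c (λ t → g (suc t) + h t)
    ≡⟨ cong (_+_ (f 0)) (sumTo-+ c (λ t → g (suc t)) h) ⟩
  f 0 + (sumTo c (λ t → g (suc t)) + sumTo c h)
    ≡⟨ +-assoc (g 0) (sumTo c (λ t → g (suc t))) (sumTo c h) ⟨
  g 0 + sumTo c (λ t → g (suc t)) + sumTo c h
    ≡⟨ cong (_+ sumTo c h) (sumTo-suc-head c g) ⟨
  sumTo (suc c) g + sumTo c h
    ≡⟨ cong₂ _+_ (sum-convolution-term b (suc c) x) (sum-convolution-term b c (x + 1ℚ)) ⟩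
  binom (ℕ→ℚ b) (suc c) + binom (ℕ→ℚ b) c
    ≡⟨ binom-pascal c (ℕ→ℚ b) ⟨
  binom (ℕ→ℚ b + 1ℚ) (suc c)
    ≡⟨ cong (λ t → binom t (suc c)) (ℕ→ℚ-suc b) ⟨
  binom (ℕ→ℚ (suc b)) (suc c)
    ∎
  where
  -- f 0 and g 0 agree definitionally: their first factor is binom _ 0 = 1ℚ.
  f = convolution-term x (suc b) (suc c)
  g = convolution-term x b (suc c)
  h = convolution-term (x + 1ℚ) b c

binomℤ-pascal : ∀ y m → binomℤ (y + 1ℚ) (sucℤ m) ≡ binomℤ y (sucℤ m) + binomℤ y m
binomℤ-pascal y (+ k)         = binom-pascal k y
binomℤ-pascal y -[1+ zero ]   = refl
binomℤ-pascal y -[1+ suc j ]  = refl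

0⊖n≡sucℤ-[1+n] : ∀ n → 0 ⊖ n ≡ sucℤ -[1+ n ]
0⊖n≡sucℤ-[1+n] zero    = refl
0⊖n≡sucℤ-[1+n] (suc n) = refl

m<n⇒m⊖n≡-[1+n∸1+m] : ∀ {m n} → m < n → m ⊖ n ≡ -[1+ n ∸ suc m ]
m<n⇒m⊖n≡-[1+n∸1+m] m<n = trans (ℤ.⊖-< m<n) (cong (λ k → ℤ.- (+ k)) (ℕ.+-∸-assoc 1 m<n))

module _ (a c : ℕ) (x : ℚ) where

  lhs-term : ℕ → ℚ
  lhs-term n = binom (ℕ→ℚ n) c * binomℤ (x + ℕ→ℚ n) (n ⊖ a)

  rhs-term : (ℕ → ℚ) → ℤ → ℕ → ℚ
  rhs-term u m s =
    binomℤ (u s) m * binomℤ (x + ℕ→ℚ a + ℕ→ℚ s) (s ⊖ 0)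
      * binomℤ (x + ℕ→ℚ c) (c ⊖ s) * sgn (c ∸ s)

  rhs-sum : (ℕ → ℚ) → ℤ → ℚ
  rhs-sum u m = sumTo c (rhs-term u m)

  rhs-sum-cong : ∀ {u v} → (∀ s → u s ≡ v s) → ∀ m → rhs-sum u m ≡ rhs-sum v m
  rhs-sum-cong u≗v m = sumTo-cong c (λ s _ → cong (λ t → rhs-term (λ _ → t) m s) (u≗v s))

  rhs-sum-negative : ∀ u j → rhs-sum u -[1+ j ] ≡ 0ℚ
  rhs-sum-negative u j = trans (sumTo-cong c (λ s _ → vanish (binomℤ (x + ℕ→ℚ a + ℕ→ℚ s) (s ⊖ 0))
                                                       (binomℤ (x + ℕ→ℚ c) (c ⊖ s)) (sgn (c ∸ s))))
                               (sumTo-0 c)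
    where
    vanish : ∀ p q r → 0ℚ * p * q * r ≡ 0ℚ
    vanish = solve-∀ ℚ-ring

  rhs-sum-pascal : ∀ u m → rhs-sum (λ s → u s + 1ℚ) (sucℤ m) ≡ rhs-sum u (sucℤ m) + rhs-sum u m
  rhs-sum-pascal u m = trans (sumTo-cong c (λ s _ → split s)) (sumTo-+ c (rhs-term u (sucℤ m)) (rhs-term u m))
    where
    distrib : ∀ p q d e s → (p + q) * d * e * s ≡ p * d * e * s + q * d * e * s
    distrib = solve-∀ ℚ-ring
    split : ∀ s → rhs-term (λ s → u s + 1ℚ) (sucℤ m) s ≡ rhs-term u (sucℤ m) s + rhs-term u m s
    split s = trans (cong (λ t → t * A * B * e) (binomℤ-pascal (u s) m))
                    (distrib (binomℤ (u s) (sucℤ m)) (binomℤ (u s) m) A B e)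
      where
      A = binomℤ (x + ℕ→ℚ a + ℕ→ℚ s) (s ⊖ 0)
      B = binomℤ (x + ℕ→ℚ c) (c ⊖ s)
      e = sgn (c ∸ s)

  rhs-sum-trinomial : ∀ n k → a ℕ.+ k ≡ n →
    rhs-sum (λ s → x + ℕ→ℚ n + ℕ→ℚ s) (+ k) ≡ binom (x + ℕ→ℚ n) k * binom (ℕ→ℚ n) c
  rhs-sum-trinomial n k a+k≡n = begin
    rhs-sum (λ s → x + ℕ→ℚ n + ℕ→ℚ s) (+ k)
      ≡⟨ sumTo-cong c factor-term ⟩
    sumTo c (λ s → binom (x + ℕ→ℚ n) k * convolution-term x n c s)
      ≡⟨ sumTo-*ˡ c (binom (x + ℕ→ℚ n) k) (convolution-term x n c) ⟩
    binom (x + ℕ→ℚ n) k * sumTo c (convolution-term x n c)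
      ≡⟨ cong (_*_ (binom (x + ℕ→ℚ n) k)) (sum-convolution-term n c x) ⟩
    binom (x + ℕ→ℚ n) k * binom (ℕ→ℚ n) c
      ∎
    where
    drop-k : ∀ x p q r → (x + (p + q) + r) - q ≡ x + p + r
    drop-k = solve-∀ ℚ-ring
    drop-s : ∀ y s → (y + s) - s ≡ y
    drop-s = solve-∀ ℚ-ring
    regroup : ∀ p q d e → p * q * d * e ≡ q * (p * d * e)
    regroup = solve-∀ ℚ-ring
    factor-term : ∀ s → s ≤ c →
      rhs-term (λ s → x + ℕ→ℚ n + ℕ→ℚ s) (+ k) s
        ≡ binom (x + ℕ→ℚ n) k * convolution-term x n c s
    factor-term s s≤c = begin
      binom Y k * binom (x + ℕ→ℚ a + ℕ→ℚ s) s * binomℤ (x + ℕ→ℚ c) (c ⊖ s) * e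
        ≡⟨ cong (λ i → binom Y k * binom (x + ℕ→ℚ a + ℕ→ℚ s) s * binomℤ (x + ℕ→ℚ c) i * e)
                (ℤ.⊖-≥ s≤c) ⟩
      binom Y k * binom (x + ℕ→ℚ a + ℕ→ℚ s) s * d * e
        ≡⟨ cong (λ t → binom Y k * binom t s * d * e) Y-k≡ ⟨
      binom Y k * binom (Y - ℕ→ℚ k) s * d * e
        ≡⟨ cong (λ t → t * d * e) (binom-*-binom-comm s k Y) ⟩
      binom Y s * binom (Y - ℕ→ℚ s) k * d * e
        ≡⟨ cong (λ t → binom Y s * binom t k * d * e) (drop-s (x + ℕ→ℚ n) (ℕ→ℚ s)) ⟩
      binom Y s * binom (x + ℕ→ℚ n) k * d * e
        ≡⟨ regroup (binom Y s) (binom (x + ℕ→ℚ n) k) d e ⟩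
      binom (x + ℕ→ℚ n) k * convolution-term x n c s
        ∎
      where
      Y = x + ℕ→ℚ n + ℕ→ℚ s
      d = binom (x + ℕ→ℚ c) (c ∸ s)
      e = sgn (c ∸ s)
      n≡a+k : ℕ→ℚ n ≡ ℕ→ℚ a + ℕ→ℚ k
      n≡a+k = trans (cong ℕ→ℚ (sym a+k≡n)) (ℕ→ℚ-+ a k)
      Y-k≡ : Y - ℕ→ℚ k ≡ x + ℕ→ℚ a + ℕ→ℚ s
      Y-k≡ = trans (cong (λ t → (x + t + ℕ→ℚ s) - ℕ→ℚ k) n≡a+k)
                   (drop-k x (ℕ→ℚ a) (ℕ→ℚ k) (ℕ→ℚ s))

  rhs-sum-diagonal : ∀ n → rhs-sum (λ s → x + ℕ→ℚ n + ℕ→ℚ s) (n ⊖ a) ≡ lhs-term n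
  rhs-sum-diagonal n with a ℕ.≤? n
  ... | yes a≤n = begin
    rhs-sum u (n ⊖ a)
      ≡⟨ cong (rhs-sum u) n⊖a≡k ⟩
    rhs-sum u (+ k)
      ≡⟨ rhs-sum-trinomial n k (ℕ.m+[n∸m]≡n a≤n) ⟩
    binom (x + ℕ→ℚ n) k * binom (ℕ→ℚ n) c
      ≡⟨ *-comm (binom (x + ℕ→ℚ n) k) (binom (ℕ→ℚ n) c) ⟩
    binom (ℕ→ℚ n) c * binomℤ (x + ℕ→ℚ n) (+ k)
      ≡⟨ cong (λ i → binom (ℕ→ℚ n) c * binomℤ (x + ℕ→ℚ n) i) n⊖a≡k ⟨
    lhs-term n
      ∎
    where
    u = λ s → x + ℕ→ℚ n + ℕ→ℚ s
    k = n ∸ a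
    n⊖a≡k : n ⊖ a ≡ + k
    n⊖a≡k = ℤ.⊖-≥ a≤n
  ... | no a≰n = begin
    rhs-sum u (n ⊖ a)
      ≡⟨ cong (rhs-sum u) n⊖a≡-[1+j] ⟩
    rhs-sum u -[1+ j ]
      ≡⟨ rhs-sum-negative u j ⟩
    0ℚ
      ≡⟨ *-zeroʳ (binom (ℕ→ℚ n) c) ⟨
    binom (ℕ→ℚ n) c * binomℤ (x + ℕ→ℚ n) -[1+ j ]
      ≡⟨ cong (λ i → binom (ℕ→ℚ n) c * binomℤ (x + ℕ→ℚ n) i) n⊖a≡-[1+j] ⟨
    lhs-term n
      ∎
    where
    u = λ s → x + ℕ→ℚ n + ℕ→ℚ s
    j = a ∸ suc n
    n⊖a≡-[1+j] : n ⊖ a ≡ -[1+ j ]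
    n⊖a≡-[1+j] = m<n⇒m⊖n≡-[1+n∸1+m] (ℕ.≰⇒> a≰n)

  rhs-sum-step : ∀ n m → n ⊖ a ≡ sucℤ m →
    rhs-sum (λ s → x + ℕ→ℚ n + ℕ→ℚ s + 1ℚ) (n ⊖ a)
      ≡ lhs-term n + rhs-sum (λ s → x + ℕ→ℚ n + ℕ→ℚ s) m
  rhs-sum-step n m n⊖a≡1+m = begin
    rhs-sum (λ s → u s + 1ℚ) (n ⊖ a)      ≡⟨ cong (rhs-sum (λ s → u s + 1ℚ)) n⊖a≡1+m ⟩
    rhs-sum (λ s → u s + 1ℚ) (sucℤ m)     ≡⟨ rhs-sum-pascal u m ⟩
    rhs-sum u (sucℤ m) + rhs-sum u m      ≡⟨ cong (λ i → rhs-sum u i + rhs-sum u m) n⊖a≡1+m ⟨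
    rhs-sum u (n ⊖ a) + rhs-sum u m       ≡⟨ cong (_+ rhs-sum u m) (rhs-sum-diagonal n) ⟩
    lhs-term n + rhs-sum u m              ∎
    where
    u = λ s → x + ℕ→ℚ n + ℕ→ℚ s

  sum-lhs-term≡rhs-sum : ∀ b → sumTo b lhs-term ≡ rhs-sum (λ s → x + ℕ→ℚ b + ℕ→ℚ s + 1ℚ) (b ⊖ a)
  sum-lhs-term≡rhs-sum zero = sym (begin
    rhs-sum (λ s → u s + 1ℚ) (0 ⊖ a)      ≡⟨ rhs-sum-step 0 -[1+ a ] (0⊖n≡sucℤ-[1+n] a) ⟩
    lhs-term 0 + rhs-sum u -[1+ a ]       ≡⟨ cong (_+_ (lhs-term 0)) (rhs-sum-negative u a) ⟩
    lhs-term 0 + 0ℚ                       ≡⟨ +-identityʳ (lhs-term 0) ⟩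
    lhs-term 0                            ∎)
    where
    u = λ s → x + ℕ→ℚ 0 + ℕ→ℚ s
  sum-lhs-term≡rhs-sum (suc b) = begin
    sumTo b lhs-term + lhs-term (suc b)
      ≡⟨ cong (_+ lhs-term (suc b)) (sum-lhs-term≡rhs-sum b) ⟩
    rhs-sum (λ s → u s + 1ℚ) (b ⊖ a) + lhs-term (suc b)
      ≡⟨ cong (_+ lhs-term (suc b)) (rhs-sum-cong shift (b ⊖ a)) ⟩
    rhs-sum v (b ⊖ a) + lhs-term (suc b)
      ≡⟨ +-comm (rhs-sum v (b ⊖ a)) (lhs-term (suc b)) ⟩
    lhs-term (suc b) + rhs-sum v (b ⊖ a)
      ≡⟨ rhs-sum-step (suc b) (b ⊖ a) (sym (ℤ.distribʳ-⊖-+-pos 1 b a)) ⟨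
    rhs-sum (λ s → v s + 1ℚ) (suc b ⊖ a)
      ∎
    where
    u = λ s → x + ℕ→ℚ b + ℕ→ℚ s
    v = λ s → x + ℕ→ℚ (suc b) + ℕ→ℚ s
    reassoc : ∀ x p q → x + p + q + 1ℚ ≡ x + (p + 1ℚ) + q
    reassoc = solve-∀ ℚ-ring
    shift : ∀ s → u s + 1ℚ ≡ v s
    shift s = trans (reassoc x (ℕ→ℚ b) (ℕ→ℚ s))
                    (cong (λ t → x + t + ℕ→ℚ s) (sym (ℕ→ℚ-suc b)))

lemma7p1 : (a b c : ℕ) → a ≤ b → c ≤ b → (x : ℚ) →
    sumTo b (λ l → binom (ℕ→ℚ l) c * binomℤ (x + ℕ→ℚ l) (l ⊖ a))
      ≡ sumTo c (λ s → binomℤ (x + ℕ→ℚ b + ℕ→ℚ s + ℕ→ℚ 1) (b ⊖ a)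
                        * binomℤ (x + ℕ→ℚ a + ℕ→ℚ s) (s ⊖ 0)
                        * binomℤ (x + ℕ→ℚ c) (c ⊖ s)
                        * sgn (c ∸ s))
lemma7p1 a b c _ _ x = sum-lhs-term≡rhs-sum a c x b
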